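{- Let $t=(t_k,t_{k-1},\dots,t_1)\in\mathbb{Z}_{>0}^k$ with $t_k>t_{k-1}>\dots>t_1$. If $t_i=t_{i-1}+1$ for some $2\le i\le k$, then $F_t=0$.
   Context: On $\mathbb{Q}[x_1,\dots,x_n,y_1,\dots,y_n]$, $E_a=\sum_{i=1}^ny_i\partial_{x_i}^a$ for $a>0$ (these operators commute), and $F_t=\det\big(E_{t_{k-j+1}+(j-i)}\big)_{i,j=1}^k=\sum_{w\in S_k}(-1)^{\ell(w)}E_{t_k+1-w(1)}E_{t_{k-1}+2-w(2)}\cdots E_{t_1+k-w(k)}$, $\ell(w)$ the number of inversions of $w$. -}

module Defs where

open import Data.Nat as ℕ using (ℕ; zero; suc; pred; _∸_; _<ᵇ_)
open import Data.Integer using (+_)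
open import Data.Rational using (ℚ; 0ℚ; 1ℚ; -_; _+_; _*_; _/_)
open import Data.Fin using (Fin; toℕ; opposite)
open import Data.Vec using (Vec; lookup; _[_]%=_)
import Data.Vec.Properties as VecP
import Data.Product.Properties as ProdP
open import Data.List using (List; []; _∷_; map; concatMap; foldr; zipWith; allFin; _++_)
open import Data.Product using (_×_; _,_)
open import Data.Bool using (if_then_else_)
open import Relation.Nullary.Decidable using (does)
open import Relation.Binary.Definitions using (DecidableEquality)

-- Monomial x^α y^β : pair of exponent vectors (α , β)
Mono : ℕ → Set
Mono n = Vec ℕ n × Vec ℕ n

_≟M_ : ∀ {n} → DecidableEquality (Mono n)
_≟M_ = ProdP.≡-dec (VecP.≡-dec ℕ._≟_) (VecP.≡-dec ℕ._≟_)

-- A polynomial, represented as a finite list of terms (coefficient , monomial);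
-- its meaning is the sum of its terms, read off by `coeff`.
Poly : ℕ → Set
Poly n = List (ℚ × Mono n)

coeff : ∀ {n} → Poly n → Mono n → ℚ
coeff []             m = 0ℚ
coeff ((c , m') ∷ p) m = (if does (m' ≟M m) then c else 0ℚ) + coeff p m

ℕ→ℚ : ℕ → ℚ
ℕ→ℚ m = + m / 1

-- falling factorial m (m-1) ... (m-a+1); it equals the scalar with
-- ∂^a x^m = fall m a · x^(m-a)  (and is 0 when a > m)
fall : ℕ → ℕ → ℕ
fall m zero    = 1
fall m (suc a) = m ℕ.* fall (pred m) a

-- Linear operators and E_a = Σ_i y_i ∂_{x_i}^a

Op : ℕ → Set
Op n = Poly n → Poly n

E-term : ∀ {n} → ℕ → ℚ × Mono n → Poly n
E-term {n} a (c , (α , β)) =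
  map (λ i → (c * ℕ→ℚ (fall (lookup α i) a) ,
              ((α [ i ]%= (λ e → e ∸ a)) , (β [ i ]%= suc))))
      (allFin n)

E : ∀ {n} → ℕ → Op n
E a p = concatMap (E-term a) p

scale : ∀ {n} → ℚ → Poly n → Poly n
scale r = map (λ { (c , m) → (r * c , m) })

-- The symmetric group S_k, as the list of all arrangements w = [w(1),…,w(k)]
-- of the elements of Fin k (Fin k standing for {1,…,k}, value j ↦ j+1).

insertions : {A : Set} → A → List A → List (List A)
insertions x []       = (x ∷ []) ∷ []
insertions x (y ∷ ys) = (x ∷ y ∷ ys) ∷ map (y ∷_) (insertions x ys)

perms : {A : Set} → List A → List (List A)
perms []       = [] ∷ []
perms (x ∷ xs) = concatMap (insertions x) (perms xs)

S : (k : ℕ) → List (List (Fin k))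
S k = perms (allFin k)

inversions : ∀ {k} → List (Fin k) → ℕ
inversions []       = 0
inversions (x ∷ xs) =
  foldr ℕ._+_ 0 (map (λ y → if toℕ y <ᵇ toℕ x then 1 else 0) xs) ℕ.+ inversions xs

sign : ℕ → ℚ
sign zero    = 1ℚ
sign (suc l) = - sign l

-- F_t = Σ_{w ∈ S_k} (-1)^{ℓ(w)} E_{t_k+1-w(1)} E_{t_{k-1}+2-w(2)} ⋯ E_{t_1+k-w(k)}
--
-- t : Fin k → ℕ with  t i = t_{toℕ i + 1}  (so t_1,…,t_k in the paper's indexing).
-- For j = toℕ jf + 1 (jf : Fin k) the j-th factor is E_{t_{k+1-j} + j - w(j)};
-- t_{k+1-j} = t (opposite jf), w(j) = toℕ (w jf) + 1.

subscripts : ∀ {k} → (Fin k → ℕ) → List (Fin k) → List ℕ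
subscripts {k} t w =
  zipWith (λ jf wj → (t (opposite jf) ℕ.+ suc (toℕ jf)) ∸ suc (toℕ wj)) (allFin k) w

Eprod : ∀ {n} → List ℕ → Op n
Eprod []       p = p
Eprod (a ∷ as) p = E a (Eprod as p)

F : ∀ {n k} → (Fin k → ℕ) → Op n
F {n} {k} t p =
  concatMap (λ w → scale (sign (inversions w)) (Eprod (subscripts t w) p)) (S k)

-- Write c_j = t_{k+1-j} + j for the row constants.  Then F_t is the
-- determinant det(E_{c_j - w})_{j,w}, and t_i = t_{i-1} + 1 says exactly that
-- two adjacent row constants coincide: the matrix has two equal adjacent
-- rows.  Because the E_a commute, the classical argument goes through: we
-- expand along the smallest column (Laplace expansion); the terms coming from
-- the two equal rows cancel, and every other term is a smaller determinant
-- that still has two equal adjacent rows, hence vanishes by induction.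
--
-- Polynomials are lists of terms, so "E_a E_b = E_b E_a" holds up to
-- reordering of the term list (_↭_), which the coefficient map ignores.
module Submission where

open import Defs
open import Data.Nat as ℕ using (ℕ; zero; suc; _∸_; _<_; _≤_; _<ᵇ_; s≤s)
import Data.Nat.Properties as ℕP
open import Algebra.Properties.CommutativeSemigroup ℕP.+-commutativeSemigroup
  using (x∙yz≈y∙xz)
import Data.Integer as ℤ
import Data.Integer.Properties as ℤP
open import Data.Rational using (ℚ; mkℚ; 0ℚ; 1ℚ; -_; _+_; _*_; _/_)
import Data.Rational.Properties as ℚP
open import Data.Rational.Solver using (module +-*-Solver)
import Data.Nat.Coprimality as Coprimality
open import Data.Fin as Fin using (Fin; toℕ; opposite)
import Data.Fin.Properties as FinP
open import Data.Vec using (lookup; _[_]%=_)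
import Data.Vec.Properties as VecP
open import Data.List as List
  using (List; []; _∷_; _++_; map; concatMap; zipWith; foldr; length; allFin; tabulate)
import Data.List.Properties as ListP
open import Data.List.Relation.Unary.All as All using (All; []; _∷_)
import Data.List.Relation.Unary.All.Properties as AllP
open import Data.List.Relation.Unary.AllPairs using (AllPairs; _∷_)
open import Data.List.Relation.Unary.AllPairs.Properties using (tabulate⁺-<)
open import Data.List.Relation.Binary.Permutation.Propositional as Perm
  using (_↭_; ↭-refl; ↭-sym; ↭-trans; ↭-reflexive)
import Data.List.Relation.Binary.Permutation.Propositional.Properties as PermP
open import Data.Product using (Σ; _×_; _,_)
open import Data.Bool using (true; false; if_then_else_)
open import Data.Empty using (⊥-elim)
open import Function using (_∘_)
open import Relation.Nullary using (yes; no; does)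
open import Relation.Binary.PropositionalEquality

private
  variable
    A B C : Set

ℕ→ℚ-* : ∀ a b → ℕ→ℚ (a ℕ.* b) ≡ ℕ→ℚ a * ℕ→ℚ b
ℕ→ℚ-* a b = begin
  ℤ.+ (a ℕ.* b) / 1                             ≡⟨ cong (_/ 1) (ℤP.pos-* a b) ⟩
  mkℚ (ℤ.+ a) 0 (unit a) * mkℚ (ℤ.+ b) 0 (unit b)  ≡⟨ cong₂ _*_ (integral a) (integral b) ⟩
  ℕ→ℚ a * ℕ→ℚ b                                ∎
  where
  open ≡-Reasoning
  unit : ∀ c → Coprimality.Coprime c 1
  unit c = Coprimality.sym (Coprimality.1-coprimeTo c)
  integral : ∀ c → mkℚ (ℤ.+ c) 0 (unit c) ≡ ℕ→ℚ c
  integral c = sym (ℚP.↥p/↧p≡p (mkℚ (ℤ.+ c) 0 (unit c)))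

sign-+ : ∀ a b → sign (a ℕ.+ b) ≡ sign a * sign b
sign-+ zero    b = sym (ℚP.*-identityˡ (sign b))
sign-+ (suc a) b = trans (cong -_ (sign-+ a b)) (ℚP.neg-distribˡ-* (sign a) (sign b))

-- ∂^a ∂^b = ∂^(b+a) on x^e, at the level of the scalars produced.
fall-+ : ∀ e b a → fall e b ℕ.* fall (e ∸ b) a ≡ fall e (b ℕ.+ a)
fall-+ e zero    a = ℕP.+-identityʳ (fall e a)
fall-+ zero    (suc b) a = refl
fall-+ (suc e) (suc b) a =
  trans (ℕP.*-assoc (suc e) (fall e b) (fall (e ∸ b) a)) (cong (suc e ℕ.*_) (fall-+ e b a))

fall-swap : ∀ x a b → ℕ→ℚ (fall x b) * ℕ→ℚ (fall (x ∸ b) a) ≡ ℕ→ℚ (fall x a) * ℕ→ℚ (fall (x ∸ a) b)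
fall-swap x a b = begin
  ℕ→ℚ (fall x b) * ℕ→ℚ (fall (x ∸ b) a) ≡⟨ sym (ℕ→ℚ-* (fall x b) (fall (x ∸ b) a)) ⟩
  ℕ→ℚ (fall x b ℕ.* fall (x ∸ b) a)     ≡⟨ cong ℕ→ℚ (fall-+ x b a) ⟩
  ℕ→ℚ (fall x (b ℕ.+ a))                ≡⟨ cong (ℕ→ℚ ∘ fall x) (ℕP.+-comm b a) ⟩
  ℕ→ℚ (fall x (a ℕ.+ b))                ≡⟨ cong ℕ→ℚ (sym (fall-+ x a b)) ⟩
  ℕ→ℚ (fall x a ℕ.* fall (x ∸ a) b)     ≡⟨ ℕ→ℚ-* (fall x a) (fall (x ∸ a) b) ⟩
  ℕ→ℚ (fall x a) * ℕ→ℚ (fall (x ∸ a) b) ∎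
  where open ≡-Reasoning

sumList : List A → (A → ℚ) → ℚ
sumList []       f = 0ℚ
sumList (a ∷ as) f = f a + sumList as f

sumTo : ℕ → (ℕ → ℚ) → ℚ
sumTo zero    f = 0ℚ
sumTo (suc N) f = f 0 + sumTo N (f ∘ suc)

sumList-++ : (as bs : List A) (f : A → ℚ) → sumList (as ++ bs) f ≡ sumList as f + sumList bs f
sumList-++ []       bs f = sym (ℚP.+-identityˡ _)
sumList-++ (a ∷ as) bs f = trans (cong (f a +_) (sumList-++ as bs f)) (sym (ℚP.+-assoc (f a) _ _))

sumList-concatMap : (g : A → List B) (as : List A) (f : B → ℚ) →
  sumList (concatMap g as) f ≡ sumList as (λ a → sumList (g a) f)
sumList-concatMap g []       f = refl
sumList-concatMap g (a ∷ as) f =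
  trans (sumList-++ (g a) (concatMap g as) f) (cong (sumList (g a) f +_) (sumList-concatMap g as f))

sumList-map : (g : A → B) (as : List A) (f : B → ℚ) → sumList (map g as) f ≡ sumList as (f ∘ g)
sumList-map g []       f = refl
sumList-map g (a ∷ as) f = cong (f (g a) +_) (sumList-map g as f)

sumList-cong : {as : List A} {f g : A → ℚ} → All (λ a → f a ≡ g a) as → sumList as f ≡ sumList as g
sumList-cong []         = refl
sumList-cong (e ∷ es) = cong₂ _+_ e (sumList-cong es)

sumList-scale : (as : List A) (r : ℚ) (f : A → ℚ) → sumList as (λ a → r * f a) ≡ r * sumList as f
sumList-scale []       r f = sym (ℚP.*-zeroʳ r)
sumList-scale (a ∷ as) r f =
  trans (cong (r * f a +_) (sumList-scale as r f)) (sym (ℚP.*-distribˡ-+ r (f a) _))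

sumTo-cong : (N : ℕ) {f g : ℕ → ℚ} → (∀ q → q < N → f q ≡ g q) → sumTo N f ≡ sumTo N g
sumTo-cong zero    e = refl
sumTo-cong (suc N) e = cong₂ _+_ (e 0 (s≤s ℕ.z≤n)) (sumTo-cong N (λ q q<N → e (suc q) (s≤s q<N)))

sumTo-zero : (N : ℕ) → sumTo N (λ _ → 0ℚ) ≡ 0ℚ
sumTo-zero zero    = refl
sumTo-zero (suc N) = trans (ℚP.+-identityˡ _) (sumTo-zero N)

sumTo-+ : (N : ℕ) (f g : ℕ → ℚ) → sumTo N (λ q → f q + g q) ≡ sumTo N f + sumTo N g
sumTo-+ zero    f g = refl
sumTo-+ (suc N) f g =
  trans (cong ((f 0 + g 0) +_) (sumTo-+ N (f ∘ suc) (g ∘ suc)))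
        (solve 4 (λ a b c d → (a :+ b) :+ (c :+ d) := (a :+ c) :+ (b :+ d)) refl (f 0) (g 0) _ _)
  where open +-*-Solver using (solve; _:+_; _:=_)

sumTo-neg : (N : ℕ) (f : ℕ → ℚ) → sumTo N (λ q → - f q) ≡ - sumTo N f
sumTo-neg zero    f = refl
sumTo-neg (suc N) f = trans (cong (- f 0 +_) (sumTo-neg N (f ∘ suc))) (sym (ℚP.neg-distrib-+ (f 0) _))

sumList-sumTo : (as : List A) (N : ℕ) (h : ℕ → A → ℚ) →
  sumList as (λ a → sumTo N (λ q → h q a)) ≡ sumTo N (λ q → sumList as (h q))
sumList-sumTo []       N h = sym (sumTo-zero N)
sumList-sumTo (a ∷ as) N h =
  trans (cong (sumTo N (λ q → h q a) +_) (sumList-sumTo as N h)) (sym (sumTo-+ N (λ q → h q a) _))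

module _ {n : ℕ} (m : Mono n) where

  private
    contribution : ℚ × Mono n → ℚ
    contribution (c , m′) = if does (m′ ≟M m) then c else 0ℚ

  coeff-++ : (p q : Poly n) → coeff (p ++ q) m ≡ coeff p m + coeff q m
  coeff-++ []      q = sym (ℚP.+-identityˡ (coeff q m))
  coeff-++ (τ ∷ p) q =
    trans (cong (contribution τ +_) (coeff-++ p q)) (sym (ℚP.+-assoc (contribution τ) _ _))

  coeff-↭ : {p q : Poly n} → p ↭ q → coeff p m ≡ coeff q m
  coeff-↭ Perm.refl          = refl
  coeff-↭ (Perm.prep τ r)    = cong (contribution τ +_) (coeff-↭ r)
  coeff-↭ (Perm.swap τ σ r)  =
    trans (sym (ℚP.+-assoc (contribution τ) (contribution σ) _))
      (trans (cong₂ _+_ (ℚP.+-comm (contribution τ) (contribution σ)) (coeff-↭ r))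
        (ℚP.+-assoc (contribution σ) (contribution τ) _))
  coeff-↭ (Perm.trans r s)   = trans (coeff-↭ r) (coeff-↭ s)

  coeff-scale : (r : ℚ) (p : Poly n) → coeff (scale r p) m ≡ r * coeff p m
  coeff-scale r [] = sym (ℚP.*-zeroʳ r)
  coeff-scale r ((c , m′) ∷ p) with does (m′ ≟M m)
  ... | true  = trans (cong (r * c +_) (coeff-scale r p)) (sym (ℚP.*-distribˡ-+ r c (coeff p m)))
  ... | false = trans (ℚP.+-identityˡ _)
                  (trans (coeff-scale r p) (cong (r *_) (sym (ℚP.+-identityˡ (coeff p m)))))

  coeff-concatMap : (g : A → Poly n) (as : List A) →
    coeff (concatMap g as) m ≡ sumList as (λ a → coeff (g a) m)
  coeff-concatMap g []       = refl
  coeff-concatMap g (a ∷ as) =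
    trans (coeff-++ (g a) (concatMap g as)) (cong (coeff (g a) m +_) (coeff-concatMap g as))

concatMap-↭ : (f : A → List B) {xs ys : List A} → xs ↭ ys → concatMap f xs ↭ concatMap f ys
concatMap-↭ f Perm.refl          = ↭-refl
concatMap-↭ f (Perm.prep x r)    = PermP.++⁺ˡ (f x) (concatMap-↭ f r)
concatMap-↭ f (Perm.swap x y r)  =
  ↭-trans (PermP.shifts (f x) (f y)) (PermP.++⁺ˡ (f y) (PermP.++⁺ˡ (f x) (concatMap-↭ f r)))
concatMap-↭ f (Perm.trans r s)   = ↭-trans (concatMap-↭ f r) (concatMap-↭ f s)

concatMap-transpose : {A B C : Set} (U : A → B → C) (xs : List A) (ys : List B) →
  concatMap (λ x → map (U x) ys) xs ↭ concatMap (λ y → map (λ x → U x y) xs) ys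
concatMap-transpose {B = B} {C = C} U [] ys = ↭-reflexive (sym (empty-rows ys))
  where
  empty-rows : (zs : List B) → concatMap (λ _ → List.[] {A = C}) zs ≡ []
  empty-rows []       = refl
  empty-rows (_ ∷ zs) = empty-rows zs
concatMap-transpose {B = B} U (x ∷ xs) ys =
  ↭-trans (PermP.++⁺ˡ (map (U x) ys) (concatMap-transpose U xs ys)) (interleave ys)
  where
  interleave : (ys : List B) → map (U x) ys ++ concatMap (λ y → map (λ x′ → U x′ y) xs) ys
                 ↭ concatMap (λ y → U x y ∷ map (λ x′ → U x′ y) xs) ys
  interleave []       = ↭-refl
  interleave (y ∷ ys) =
    Perm.prep (U x y) (↭-trans (PermP.shifts (map (U x) ys) column) (PermP.++⁺ˡ column (interleave ys)))
    where column = map (λ x′ → U x′ y) xs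

module _ {n : ℕ} where

  φ : ℕ → ℕ → ℚ
  φ e a = ℕ→ℚ (fall e a)

  -- The summand y_i ∂_{x_i}^a of E_a acting on a single term; by definition
  -- E-term a τ is the list of the y∂ a i τ over all variables i.
  y∂ : ℕ → Fin n → ℚ × Mono n → ℚ × Mono n
  y∂ a i (c , (α , β)) = (c * φ (lookup α i) a , ((α [ i ]%= (λ e → e ∸ a)) , (β [ i ]%= suc)))

  y∂-comm : ∀ a b i j (τ : ℚ × Mono n) → y∂ a j (y∂ b i τ) ≡ y∂ b i (y∂ a j τ)
  y∂-comm a b i j (c , (α , β)) with i Fin.≟ j
  ... | yes refl = cong₂ _,_ (trans (twice a b) (sym (trans (twice b a) (cong (c *_) (fall-swap x b a)))))
                             (cong₂ _,_ exponents refl)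
    where
    x = lookup α i
    twice : ∀ a b → (c * φ x b) * φ (lookup (α [ i ]%= (λ e → e ∸ b)) i) a ≡ c * (φ x b * φ (x ∸ b) a)
    twice a b = trans (cong (λ e → (c * φ x b) * φ e a) (VecP.lookup∘updateAt i α)) (ℚP.*-assoc c _ _)
    exponents : (α [ i ]%= (λ e → e ∸ b)) [ i ]%= (λ e → e ∸ a) ≡ (α [ i ]%= (λ e → e ∸ a)) [ i ]%= (λ e → e ∸ b)
    exponents = trans (VecP.updateAt-updateAt i α)
      (trans (VecP.updateAt-cong i (λ e → trans (ℕP.∸-+-assoc e b a)
                (trans (cong (e ∸_) (ℕP.+-comm b a)) (sym (ℕP.∸-+-assoc e a b)))) α)
        (sym (VecP.updateAt-updateAt i α)))
  ... | no i≢j = cong₂ _,_ (trans (apart a b i j i≢j) (sym (trans (apart b a j i j≢i) (cong (c *_) swap))))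
                           (cong₂ _,_ (VecP.updateAt-commutes j i j≢i α) (VecP.updateAt-commutes j i j≢i β))
    where
    j≢i = i≢j ∘ sym
    swap = ℚP.*-comm (φ (lookup α j) a) (φ (lookup α i) b)
    apart : ∀ a b i j → i ≢ j →
      (c * φ (lookup α i) b) * φ (lookup (α [ i ]%= (λ e → e ∸ b)) j) a ≡ c * (φ (lookup α i) b * φ (lookup α j) a)
    apart a b i j i≢j =
      trans (cong (λ e → (c * φ (lookup α i) b) * φ e a) (VecP.lookup∘updateAt′ j i (i≢j ∘ sym) α))
            (ℚP.*-assoc c _ _)

  E-term-comm : ∀ a b (τ : ℚ × Mono n) →
    concatMap (E-term a) (E-term b τ) ↭ concatMap (E-term b) (E-term a τ)
  E-term-comm a b τ = begin
    concatMap (E-term a) (map (λ i → y∂ b i τ) (allFin n))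
      ≡⟨ ListP.concatMap-map (E-term a) _ (allFin n) ⟩
    concatMap (λ i → map (λ j → y∂ a j (y∂ b i τ)) (allFin n)) (allFin n)
      ↭⟨ concatMap-transpose (λ i j → y∂ a j (y∂ b i τ)) (allFin n) (allFin n) ⟩
    concatMap (λ j → map (λ i → y∂ a j (y∂ b i τ)) (allFin n)) (allFin n)
      ≡⟨ ListP.concatMap-cong (λ j → ListP.map-cong (λ i → y∂-comm a b i j τ) (allFin n)) (allFin n) ⟩
    concatMap (λ j → map (λ i → y∂ b i (y∂ a j τ)) (allFin n)) (allFin n)
      ≡⟨ ListP.concatMap-map (E-term b) _ (allFin n) ⟨
    concatMap (E-term b) (map (λ j → y∂ a j τ) (allFin n)) ∎
    where open Perm.PermutationReasoning

  E-comm : ∀ a b (p : Poly n) → E a (E b p) ↭ E b (E a p)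
  E-comm a b []      = ↭-refl
  E-comm a b (τ ∷ p) = begin
    E a (E-term b τ ++ E b p)               ≡⟨ ListP.concatMap-++ (E-term a) (E-term b τ) (E b p) ⟩
    E a (E-term b τ) ++ E a (E b p)         ↭⟨ PermP.++⁺ (E-term-comm a b τ) (E-comm a b p) ⟩
    E b (E-term a τ) ++ E b (E a p)         ≡⟨ ListP.concatMap-++ (E-term b) (E-term a τ) (E a p) ⟨
    E b (E-term a τ ++ E a p)               ∎
    where open Perm.PermutationReasoning

  E-Eprod : ∀ a (as : List ℕ) (p : Poly n) → E a (Eprod as p) ↭ Eprod as (E a p)
  E-Eprod a []       p = ↭-refl
  E-Eprod a (b ∷ as) p = ↭-trans (E-comm a b (Eprod as p)) (concatMap-↭ (E-term b) (E-Eprod a as p))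

-- ins q x ys inserts x before position q (at the end if q ≥ length ys).
ins : ℕ → A → List A → List A
ins zero    x ys       = x ∷ ys
ins (suc q) x []       = x ∷ []
ins (suc q) x (y ∷ ys) = y ∷ ins q x ys

del : ℕ → List A → List A
del q       []       = []
del zero    (y ∷ ys) = ys
del (suc q) (y ∷ ys) = y ∷ del q ys

nth : ℕ → List ℕ → ℕ
nth q       []       = 0
nth zero    (c ∷ cs) = c
nth (suc q) (c ∷ cs) = nth q cs

length-del : (q : ℕ) (ys : List A) → q < length ys → suc (length (del q ys)) ≡ length ys
length-del zero    (y ∷ ys) _         = refl
length-del (suc q) (y ∷ ys) (s≤s q<) = cong suc (length-del q ys q<)

zipWith-ins : (f : ℕ → B → C) (q : ℕ) (x : B) (cs : List ℕ) (ys : List B) →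
  length cs ≡ suc (length ys) → q ≤ length ys →
  zipWith f cs (ins q x ys) ≡ ins q (f (nth q cs) x) (zipWith f (del q cs) ys)
zipWith-ins f zero    x (c ∷ cs) ys       _   _        = refl
zipWith-ins f (suc q) x (c ∷ cs) (y ∷ ys) len (s≤s q≤) =
  cong (f c y ∷_) (zipWith-ins f q x cs ys (ℕP.suc-injective len) q≤)

Eprod-ins : ∀ {n} q a (as : List ℕ) (p : Poly n) → Eprod (ins q a as) p ↭ Eprod as (E a p)
Eprod-ins zero    a as       p = E-Eprod a as p
Eprod-ins (suc q) a []       p = ↭-refl
Eprod-ins (suc q) a (b ∷ as) p = concatMap-↭ (E-term b) (Eprod-ins q a as p)

insertions-sum : (x : A) (ys : List A) (G : List A → ℚ) →
  sumList (insertions x ys) G ≡ sumTo (suc (length ys)) (λ q → G (ins q x ys))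
insertions-sum x []       G = refl
insertions-sum x (y ∷ ys) G =
  cong (G (x ∷ y ∷ ys) +_) (trans (sumList-map (y ∷_) (insertions x ys) G) (insertions-sum x ys (G ∘ (y ∷_))))

insertions-↭ : (x : A) (ys : List A) → All (_↭ x ∷ ys) (insertions x ys)
insertions-↭ x []       = ↭-refl ∷ []
insertions-↭ x (y ∷ ys) =
  ↭-refl ∷ AllP.map⁺ (All.map (λ u↭ → ↭-trans (Perm.prep y u↭) (Perm.swap y x ↭-refl)) (insertions-↭ x ys))

perms-↭ : (xs : List A) → All (_↭ xs) (perms xs)
perms-↭ []       = ↭-refl ∷ []
perms-↭ (x ∷ xs) = AllP.concat⁺ (AllP.map⁺ (All.map
  (λ w↭ → All.map (λ u↭ → ↭-trans u↭ (Perm.prep x w↭)) (insertions-↭ x _)) (perms-↭ xs)))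

module _ {k : ℕ} where

  -- below y z = 1 if z < y, else 0; smaller y ys counts the entries of ys
  -- below y, so that inversions (y ∷ ys) = smaller y ys + inversions ys.
  below : Fin k → Fin k → ℕ
  below y z = if toℕ z <ᵇ toℕ y then 1 else 0

  smaller : Fin k → List (Fin k) → ℕ
  smaller y ys = foldr ℕ._+_ 0 (map (below y) ys)

  below-yes : {y z : Fin k} → z Fin.< y → below y z ≡ 1
  below-yes {y} {z} z<y with toℕ z <ᵇ toℕ y | ℕP.<⇒<ᵇ z<y
  ... | true | _ = refl

  below-no : {y z : Fin k} → y Fin.< z → below y z ≡ 0
  below-no {y} {z} y<z with toℕ z <ᵇ toℕ y | ℕP.<ᵇ⇒< (toℕ z) (toℕ y)
  ... | false | _   = refl
  ... | true  | z<y = ⊥-elim (ℕP.<-asym y<z (z<y _))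

  smaller-ins : ∀ q y x (ys : List (Fin k)) → smaller y (ins q x ys) ≡ below y x ℕ.+ smaller y ys
  smaller-ins zero    y x ys       = refl
  smaller-ins (suc q) y x []       = refl
  smaller-ins (suc q) y x (z ∷ ys) =
    trans (cong (below y z ℕ.+_) (smaller-ins q y x ys)) (x∙yz≈y∙xz (below y z) (below y x) _)

  smaller-none : ∀ x (ys : List (Fin k)) → All (x Fin.<_) ys → smaller x ys ≡ 0
  smaller-none x []       []           = refl
  smaller-none x (z ∷ ys) (x<z ∷ x<ys) = cong₂ ℕ._+_ (below-no x<z) (smaller-none x ys x<ys)

  inversions-ins : ∀ q x (ys : List (Fin k)) → All (x Fin.<_) ys → q ≤ length ys →
    inversions (ins q x ys) ≡ q ℕ.+ inversions ys
  inversions-ins zero    x ys       x<ys         _        = cong (ℕ._+ inversions ys) (smaller-none x ys x<ys)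
  inversions-ins (suc q) x (y ∷ ys) (x<y ∷ x<ys) (s≤s q≤) = begin
    smaller y (ins q x ys) ℕ.+ inversions (ins q x ys)
      ≡⟨ cong₂ ℕ._+_ (smaller-ins q y x ys) (inversions-ins q x ys x<ys q≤) ⟩
    (below y x ℕ.+ smaller y ys) ℕ.+ (q ℕ.+ inversions ys)
      ≡⟨ cong (λ b → (b ℕ.+ smaller y ys) ℕ.+ (q ℕ.+ inversions ys)) (below-yes x<y) ⟩
    suc (smaller y ys ℕ.+ (q ℕ.+ inversions ys))
      ≡⟨ cong suc (x∙yz≈y∙xz (smaller y ys) q (inversions ys)) ⟩
    suc q ℕ.+ (smaller y ys ℕ.+ inversions ys) ∎
    where open ≡-Reasoning

data AdjacentRepeat {A : Set} : List A → Set where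
  here  : ∀ c xs → AdjacentRepeat (c ∷ c ∷ xs)
  there : ∀ a {xs} → AdjacentRepeat xs → AdjacentRepeat (a ∷ xs)

tabulate-repeat : ∀ {K} (h : Fin K → A) (a b : Fin K) →
  toℕ b ≡ suc (toℕ a) → h a ≡ h b → AdjacentRepeat (tabulate h)
tabulate-repeat h Fin.zero    (Fin.suc Fin.zero) _      ha≡hb =
  subst (λ z → AdjacentRepeat (h Fin.zero ∷ z ∷ tabulate (h ∘ Fin.suc ∘ Fin.suc))) ha≡hb
    (here (h Fin.zero) (tabulate (h ∘ Fin.suc ∘ Fin.suc)))
tabulate-repeat h (Fin.suc a) (Fin.suc b)        b≡a+1 ha≡hb =
  there _ (tabulate-repeat (h ∘ Fin.suc) a b (ℕP.suc-injective b≡a+1) ha≡hb)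

-- The alternating sum Σ_q (-1)^q G(L without entry q, entry q) over a list L
-- with an adjacent repeat vanishes, provided G vanishes on shorter lists
-- with an adjacent repeat: the two terms of the repeated entries cancel,
-- and deleting any other entry keeps the repeat.
alternating-vanishes : (G : List ℕ → ℕ → ℚ) (L : List ℕ) → AdjacentRepeat L →
  (∀ L′ r → AdjacentRepeat L′ → suc (length L′) ≡ length L → G L′ r ≡ 0ℚ) →
  sumTo (length L) (λ q → sign q * G (del q L) (nth q L)) ≡ 0ℚ
alternating-vanishes G (c ∷ c ∷ bs) (here c bs) G-vanishes = begin
  1ℚ * T + ((- 1ℚ) * T + sumTo (length bs) others) ≡⟨ cong (λ z → 1ℚ * T + ((- 1ℚ) * T + z)) others-vanish ⟩
  1ℚ * T + ((- 1ℚ) * T + 0ℚ)                       ≡⟨ solve 1 (λ T → con 1ℚ :* T :+ ((:- con 1ℚ) :* T :+ con 0ℚ) := con 0ℚ) refl T ⟩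
  0ℚ                                               ∎
  where
  open ≡-Reasoning
  open +-*-Solver using (solve; con; _:*_; _:+_; :-_; _:=_)
  T = G (c ∷ bs) c
  others : ℕ → ℚ
  others q = sign (suc (suc q)) * G (c ∷ c ∷ del q bs) (nth q bs)
  others-vanish : sumTo (length bs) others ≡ 0ℚ
  others-vanish = trans (sumTo-cong (length bs) (λ q q< →
      trans (cong (sign (suc (suc q)) *_) (G-vanishes _ _ (here c (del q bs)) (cong (suc ∘ suc) (length-del q bs q<))))
            (ℚP.*-zeroʳ (sign (suc (suc q))))))
    (sumTo-zero (length bs))
alternating-vanishes G (a ∷ L) (there a rep) G-vanishes = begin
  1ℚ * G L a + sumTo (length L) (λ q → - (sign q) * G (a ∷ del q L) (nth q L))
    ≡⟨ cong₂ _+_ (cong (1ℚ *_) (G-vanishes L a rep refl))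
                 (sumTo-cong (length L) (λ q _ → sym (ℚP.neg-distribˡ-* (sign q) _))) ⟩
  1ℚ * 0ℚ + sumTo (length L) (λ q → - (sign q * G (a ∷ del q L) (nth q L)))
    ≡⟨ cong (1ℚ * 0ℚ +_) (sumTo-neg (length L) _) ⟩
  1ℚ * 0ℚ + - sumTo (length L) (λ q → sign q * G (a ∷ del q L) (nth q L))
    ≡⟨ cong (λ z → 1ℚ * 0ℚ + - z) (alternating-vanishes (G ∘ (a ∷_)) L rep
         (λ L′ r rep′ len → G-vanishes (a ∷ L′) r (there a rep′) (cong suc len))) ⟩
  1ℚ * 0ℚ + - 0ℚ
    ≡⟨⟩
  0ℚ ∎
  where open ≡-Reasoning

-- Subscript of the entry in the row with constant c and column v, i.e.
-- c - (v+1) in the paper's 1-based column numbering.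
entry : ∀ {k} → ℕ → Fin k → ℕ
entry c v = c ∸ suc (toℕ v)

module Determinant {n k : ℕ} (m : Mono n) where

  term : List ℕ → Poly n → List (Fin k) → ℚ
  term cs p w = sign (inversions w) * coeff (Eprod (zipWith entry cs w) p) m

  det : List ℕ → List (Fin k) → Poly n → ℚ
  det cs xs p = sumList (perms xs) (term cs p)

  -- Inserting the smallest column x at position q contributes the sign
  -- (-1)^q and pulls the operator of row q out to act first.
  term-ins : ∀ q x (w : List (Fin k)) cs p → All (x Fin.<_) w → length cs ≡ suc (length w) → q ≤ length w →
    term cs p (ins q x w) ≡ sign q * term (del q cs) (E (entry (nth q cs) x) p) w
  term-ins q x w cs p x<w len q≤ = begin
    sign (inversions (ins q x w)) * coeff (Eprod (zipWith entry cs (ins q x w)) p) m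
      ≡⟨ cong₂ (λ l as → sign l * coeff (Eprod as p) m) (inversions-ins q x w x<w q≤)
               (zipWith-ins entry q x cs w len q≤) ⟩
    sign (q ℕ.+ inversions w) * coeff (Eprod (ins q (entry (nth q cs) x) (zipWith entry (del q cs) w)) p) m
      ≡⟨ cong₂ _*_ (sign-+ q (inversions w)) (coeff-↭ m (Eprod-ins q _ _ p)) ⟩
    (sign q * sign (inversions w)) * coeff (Eprod (zipWith entry (del q cs) w) (E (entry (nth q cs) x) p)) m
      ≡⟨ ℚP.*-assoc (sign q) _ _ ⟩
    sign q * term (del q cs) (E (entry (nth q cs) x) p) w ∎
    where open ≡-Reasoning

  laplace : ∀ x xs → All (x Fin.<_) xs → ∀ cs → length cs ≡ suc (length xs) → ∀ p →
    det cs (x ∷ xs) p ≡ sumTo (length cs) (λ q → sign q * det (del q cs) xs (E (entry (nth q cs) x) p))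
  laplace x xs x<xs cs len p = begin
    sumList (concatMap (insertions x) (perms xs)) (term cs p)
      ≡⟨ sumList-concatMap (insertions x) (perms xs) (term cs p) ⟩
    sumList (perms xs) (λ w → sumList (insertions x w) (term cs p))
      ≡⟨ sumList-cong (All.map expand (perms-↭ xs)) ⟩
    sumList (perms xs) (λ w → sumTo (length cs) (λ q → sign q * minor q w))
      ≡⟨ sumList-sumTo (perms xs) (length cs) (λ q w → sign q * minor q w) ⟩
    sumTo (length cs) (λ q → sumList (perms xs) (λ w → sign q * minor q w))
      ≡⟨ sumTo-cong (length cs) (λ q _ → sumList-scale (perms xs) (sign q) (minor q)) ⟩
    sumTo (length cs) (λ q → sign q * det (del q cs) xs (E (entry (nth q cs) x) p)) ∎
    where
    open ≡-Reasoning
    minor : ℕ → List (Fin k) → ℚ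
    minor q = term (del q cs) (E (entry (nth q cs) x) p)
    expand : ∀ {w} → w ↭ xs → sumList (insertions x w) (term cs p) ≡ sumTo (length cs) (λ q → sign q * minor q w)
    expand {w} w↭xs = begin
      sumList (insertions x w) (term cs p)                ≡⟨ insertions-sum x w (term cs p) ⟩
      sumTo (suc (length w)) (λ q → term cs p (ins q x w))
        ≡⟨ sumTo-cong (suc (length w)) (λ q q< → term-ins q x w cs p x<w len′ (ℕP.≤-pred q<)) ⟩
      sumTo (suc (length w)) (λ q → sign q * minor q w)   ≡⟨ cong (λ N → sumTo N (λ q → sign q * minor q w)) (sym len′) ⟩
      sumTo (length cs) (λ q → sign q * minor q w)        ∎
      where
      x<w : All (x Fin.<_) w
      x<w = PermP.All-resp-↭ (↭-sym w↭xs) x<xs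
      len′ : length cs ≡ suc (length w)
      len′ = trans len (cong suc (sym (PermP.↭-length w↭xs)))

  det-vanishes : ∀ xs → AllPairs Fin._<_ xs → ∀ cs → AdjacentRepeat cs → length cs ≡ length xs →
    ∀ p → det cs xs p ≡ 0ℚ
  det-vanishes []       _               _  (here _ _)  () _
  det-vanishes []       _               _  (there _ _) () _
  det-vanishes (x ∷ xs) (x<xs ∷ sorted) cs rep         len p =
    trans (laplace x xs x<xs cs len p)
      (alternating-vanishes (λ L r → det L xs (E (entry r x) p)) cs rep
        (λ L′ r rep′ len′ → det-vanishes xs sorted L′ rep′ (ℕP.suc-injective (trans len′ len)) _))

-- The row constant c_j = t_{k+1-j} + j, for the 0-based row index jf = j - 1.
rowConstant : ∀ {k} → (Fin k → ℕ) → Fin k → ℕ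
rowConstant t jf = t (opposite jf) ℕ.+ suc (toℕ jf)

coeff-F : ∀ {n k} (t : Fin k → ℕ) (p : Poly n) (m : Mono n) →
  coeff (F t p) m ≡ Determinant.det m (map (rowConstant t) (allFin k)) (allFin k) p
coeff-F {k = k} t p m = trans (coeff-concatMap m _ (S k)) (sumList-cong (All.universal summand (S k)))
  where
  summand : ∀ w → coeff (scale (sign (inversions w)) (Eprod (subscripts t w) p)) m
                  ≡ Determinant.term m (map (rowConstant t) (allFin k)) p w
  summand w = trans (coeff-scale m (sign (inversions w)) (Eprod (subscripts t w) p))
    (cong (λ as → sign (inversions w) * coeff (Eprod as p) m) (sym subscripts≡))
    where
    subscripts≡ : zipWith entry (map (rowConstant t) (allFin k)) w ≡ subscripts t w
    subscripts≡ = trans (cong (zipWith entry (map (rowConstant t) (allFin k))) (sym (ListP.map-id w)))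
                        (ListP.zipWith-map entry (rowConstant t) (λ v → v) (allFin k) w)

opposite-adjacent : ∀ {k} (i j : Fin k) → toℕ j ≡ suc (toℕ i) → toℕ (opposite i) ≡ suc (toℕ (opposite j))
opposite-adjacent {k} i j j≡i+1 = begin
  toℕ (opposite i)           ≡⟨ FinP.opposite-prop i ⟩
  suc k ∸ suc (suc (toℕ i))  ≡⟨ ℕP.+-∸-assoc 1 (subst (_< k) j≡i+1 (FinP.toℕ<n j)) ⟩
  suc (k ∸ suc (suc (toℕ i))) ≡⟨ cong (λ e → suc (k ∸ suc e)) j≡i+1 ⟨
  suc (k ∸ suc (toℕ j))      ≡⟨ cong suc (FinP.opposite-prop j) ⟨
  suc (toℕ (opposite j))     ∎
  where open ≡-Reasoning

rowConstants-repeat : ∀ {k} (t : Fin k → ℕ) (i j : Fin k) → toℕ j ≡ suc (toℕ i) → t j ≡ suc (t i) →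
  AdjacentRepeat (map (rowConstant t) (allFin k))
rowConstants-repeat t i j j≡i+1 tj≡ti+1 =
  subst AdjacentRepeat (sym (ListP.map-tabulate (λ v → v) (rowConstant t)))
    (tabulate-repeat (rowConstant t) (opposite j) (opposite i) adjacent equal)
  where
  open ≡-Reasoning
  adjacent = opposite-adjacent i j j≡i+1
  equal : rowConstant t (opposite j) ≡ rowConstant t (opposite i)
  equal = begin
    t (opposite (opposite j)) ℕ.+ suc (toℕ (opposite j)) ≡⟨ cong (λ v → t v ℕ.+ suc (toℕ (opposite j))) (FinP.opposite-involutive j) ⟩
    t j ℕ.+ suc (toℕ (opposite j))                       ≡⟨ cong (ℕ._+ _) tj≡ti+1 ⟩
    suc (t i) ℕ.+ suc (toℕ (opposite j))                 ≡⟨ ℕP.+-suc (t i) _ ⟨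
    t i ℕ.+ suc (suc (toℕ (opposite j)))                 ≡⟨ cong (λ e → t i ℕ.+ suc e) adjacent ⟨
    t i ℕ.+ suc (toℕ (opposite i))                       ≡⟨ cong (λ v → t v ℕ.+ suc (toℕ (opposite i))) (FinP.opposite-involutive i) ⟨
    t (opposite (opposite i)) ℕ.+ suc (toℕ (opposite i)) ∎

mainTheorem13 : (n k : ℕ) (t : Fin k → ℕ) →
    (∀ i → 0 < t i) →
    (∀ i j → i Fin.< j → t i < t j) →
    Σ (Fin k) (λ i → Σ (Fin k) (λ j → (toℕ j ≡ suc (toℕ i)) × (t j ≡ suc (t i)))) →
    (p : Poly n) (m : Mono n) → coeff (F t p) m ≡ 0ℚ
mainTheorem13 n k t _ _ (i , j , j≡i+1 , tj≡ti+1) p m = begin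
  coeff (F t p) m                                      ≡⟨ coeff-F t p m ⟩
  det (map (rowConstant t) (allFin k)) (allFin k) p
    ≡⟨ det-vanishes (allFin k) (tabulate⁺-< (λ i<j → i<j)) (map (rowConstant t) (allFin k))
         (rowConstants-repeat t i j j≡i+1 tj≡ti+1) (ListP.length-map (rowConstant t) (allFin k)) p ⟩
  0ℚ                                                   ∎
  where
  open ≡-Reasoning
  open Determinant {n} {k} m using (det; det-vanishes)
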